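{- In the setting below, if $\mathcal{X}$ is a nonempty set of waves that is linearly ordered by $\leq$, then $\mathcal{X}$ has a unique smallest upper bound $\sup(\mathcal{X})$ (with respect to $\leq$, among all waves).
   Context: Setting: $D=(V,A)$ is a countable digraph (multiple edges and loops allowed), $s\neq t\in V$; for each $v\in V$, $\mathcal{M}_v$ is a finitary matroid on the set $\mathsf{in}_D(v)$ of edges with head $v$, and $\mathcal{M}=\bigoplus_{v}\mathcal{M}_v$ is assumed to have no loops. Paths are finite directed paths without repeated vertices. For $X\subseteq V$, $\mathsf{in}_D(X)$ ($\mathsf{out}_D(X)$) is the set of edges entering (leaving) $X$. For $X,Y\subseteq V$, a path $P$ is an $X\rightarrow Y$ path if $V(P)\cap X=\{\mathsf{start}(P)\}$ and $V(P)\cap Y=\{\mathsf{end}(P)\}$; $s\rightarrow X$ means $\{s\}\rightarrow X$. For a path system $\mathcal{W}$, $A(\mathcal{W})$ is the union of edge sets and $A_{last}(\mathcal{W})$ the set of last edges of its paths; $\mathcal{W}$ is independent if $A(\mathcal{W})$ is $\mathcal{M}$-independent. A $t-s$ cut is a set $X$ with $t\in X\subseteq V\setminus\{s\}$. A wave is a pair $(\mathcal{W},X)$ where $X$ is a $t-s$ cut and $\mathcal{W}$ is an independent system of pairwise edge-disjoint $s\rightarrow X$ paths such that $A_{last}(\mathcal{W})$ spans $\mathsf{in}_D(X)$ in $\mathcal{M}$. A forward continuation of a path $P$ is a path having $P$ as an initial segment (possibly $P$ itself). For waves, $(\mathcal{W}_0,X_0)\leq(\mathcal{W}_1,X_1)$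 means: $X_1\subseteq X_0$; every path of $\mathcal{W}_1$ is a forward continuation of some path of $\mathcal{W}_0$ with the added terminal segment lying in $X_0$; and $\mathcal{W}_1$ contains every path of $\mathcal{W}_0$ that meets $X_1$. This is a partial order. -}

module Defs where

open import Level using (0ℓ)
open import Data.Nat using (ℕ; _<_)
open import Data.Product using (Σ; _×_; _,_; proj₁)
open import Data.Sum using (_⊎_)
open import Data.Empty using (⊥)
open import Data.Unit using (⊤)
open import Data.Maybe using (Maybe; just)
open import Data.List using (List; []; _∷_; map; length; last; _++_)
open import Data.List.Membership.Propositional using (_∈_; _∉_)
open import Data.List.Relation.Unary.Unique.Propositional using (Unique)
open import Data.List.Relation.Unary.All using (All)
open import Relation.Unary using (Pred; _⊆_)
open import Relation.Nullary using (¬_)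
open import Relation.Binary.PropositionalEquality using (_≡_)
open import Function.Definitions using (Injective)

-- A countable digraph; multiple edges and loops are allowed since
-- edges are an arbitrary type with tail/head maps.
record Digraph : Set₁ where
  field
    V : Set
    A : Set
    tail : A → V
    head : A → V
    V-countable : Σ (V → ℕ) (Injective _≡_ _≡_)
    A-countable : Σ (A → ℕ) (Injective _≡_ _≡_)

-- Finite sets are represented by duplicate-free lists.
record FinitaryMatroid (E : Set) : Set₁ where
  field
    indep : Pred E 0ℓ → Set
    indep-empty : indep (λ _ → ⊥)
    indep-down : ∀ {I J : Pred E 0ℓ} → J ⊆ I → indep I → indep J
    indep-aug : ∀ (xs ys : List E) → Unique xs → Unique ys →
                indep (λ x → x ∈ xs) → indep (λ x → x ∈ ys) →
                length xs < length ys →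
                Σ E (λ y → y ∈ ys × y ∉ xs × indep (λ x → x ≡ y ⊎ x ∈ xs))
    indep-finitary : ∀ (I : Pred E 0ℓ) →
                     (∀ (xs : List E) → (∀ x → x ∈ xs → I x) → indep (λ x → x ∈ xs)) →
                     indep I

InEdges : (D : Digraph) → Digraph.V D → Set
InEdges D v = Σ (Digraph.A D) (λ e → Digraph.head D e ≡ v)

record Path (V A : Set) : Set where
  constructor path
  field
    start : V
    edges : List A

module Setting (D : Digraph)
               (Mv : (v : Digraph.V D) → FinitaryMatroid (InEdges D v))
               (s t : Digraph.V D) where

  open Digraph D

  indepM : Pred A 0ℓ → Set
  indepM S = ∀ v → FinitaryMatroid.indep (Mv v) (λ p → S (proj₁ p))

  NoLoops : Set
  NoLoops = ∀ e → indepM (λ f → f ≡ e)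

  Spans : Pred A 0ℓ → Pred A 0ℓ → Set₁
  Spans S T = ∀ e → T e →
    S e ⊎ Σ (Pred A 0ℓ) (λ I → I ⊆ S × indepM I × ¬ indepM (λ f → f ≡ e ⊎ I f))

  P : Set
  P = Path V A

  verts : P → List V
  verts p = Path.start p ∷ map head (Path.edges p)

  endFrom : V → List A → V
  endFrom v [] = v
  endFrom v (e ∷ es) = endFrom (head e) es

  end : P → V
  end p = endFrom (Path.start p) (Path.edges p)

  Linked : V → List A → Set
  Linked v [] = ⊤
  Linked v (e ∷ es) = tail e ≡ v × Linked (head e) es

  IsPath : P → Set
  IsPath p = Linked (Path.start p) (Path.edges p) × Unique (verts p)

  IsPathFromTo : Pred V 0ℓ → Pred V 0ℓ → P → Set
  IsPathFromTo X Y p =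
    IsPath p ×
    (X (Path.start p) × (∀ u → u ∈ verts p → X u → u ≡ Path.start p)) ×
    (Y (end p) × (∀ u → u ∈ verts p → Y u → u ≡ end p))

  PathSystem : Set₁
  PathSystem = Pred P 0ℓ

  Edges : PathSystem → Pred A 0ℓ
  Edges W e = Σ P (λ p → W p × e ∈ Path.edges p)

  LastEdges : PathSystem → Pred A 0ℓ
  LastEdges W e = Σ P (λ p → W p × last (Path.edges p) ≡ just e)

  IsCut : Pred V 0ℓ → Set
  IsCut X = X t × ¬ X s

  InD : Pred V 0ℓ → Pred A 0ℓ
  InD X e = X (head e) × ¬ X (tail e)

  record Wave : Set₁ where
    field
      W : PathSystem
      X : Pred V 0ℓ
      cut : IsCut X
      paths : ∀ p → W p → IsPathFromTo (λ v → v ≡ s) X p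
      edge-disjoint : ∀ p q e → W p → W q → e ∈ Path.edges p → e ∈ Path.edges q → p ≡ q
      independent : indepM (Edges W)
      spanning : Spans (LastEdges W) (InD X)

  _≤W_ : Wave → Wave → Set
  w₀ ≤W w₁ =
    (Wave.X w₁ ⊆ Wave.X w₀) ×
    (∀ p → Wave.W w₁ p →
       Σ P (λ q → Wave.W w₀ q × Σ (List A) (λ rest →
         Path.start p ≡ Path.start q ×
         Path.edges p ≡ Path.edges q ++ rest ×
         All (λ e → Wave.X w₀ (head e)) rest))) ×
    (∀ q → Wave.W w₀ q → Σ V (λ u → u ∈ verts q × Wave.X w₁ u) → Wave.W w₁ q)

  _≈W_ : Wave → Wave → Set
  w ≈W w' =
    (∀ p → (Wave.W w p → Wave.W w' p) × (Wave.W w' p → Wave.W w p)) ×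
    (∀ v → (Wave.X w v → Wave.X w' v) × (Wave.X w' v → Wave.X w v))

  IsUpperBound : Pred Wave 0ℓ → Wave → Set₁
  IsUpperBound 𝒳 w = ∀ w' → 𝒳 w' → w' ≤W w

  IsSup : Pred Wave 0ℓ → Wave → Set₁
  IsSup 𝒳 w = IsUpperBound 𝒳 w × (∀ u → IsUpperBound 𝒳 u → w ≤W u)

module Submission where

-- The supremum of a chain 𝒳 of waves has as its cut the intersection of
-- the cuts X_w, and as its paths those paths of the waves of 𝒳 that end in
-- this intersection.  Two waves of 𝒳 are comparable, so finitely many of
-- these paths already lie in a single wave of 𝒳; this gives edge-disjointness
-- and, the matroids being finitary, independence.  For minimality, fix an
-- upper bound u and a path p of u.  Each w ∈ 𝒳 has a path q_w of which p
-- is a forward continuation; along the chain q_w only grows, and since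
-- |q_w| ≤ |p| some q_w is longest.  Edge-disjointness forces every larger
-- wave of 𝒳 to keep that q_w, so q_w ends in every cut and p extends it
-- inside the intersection.

open import Defs
open import Level using (Level; _⊔_; 0ℓ; suc; Lift; lift; lower)
open import Axiom.ExcludedMiddle using (ExcludedMiddle)
open import Data.Product using (Σ; ∃; _×_; _,_; proj₁; proj₂)
open import Data.Sum using (_⊎_; inj₁; inj₂)
open import Data.Empty using (⊥-elim)
open import Data.Nat as Nat using (ℕ; zero; _≤_; z≤n; s≤s)
open import Data.Nat.Properties using (≤-trans; ≤-pred; ≰⇒>; m≤m+n)
open import Data.List using (List; []; _∷_; map; length; last; _++_)
open import Data.List.Properties using (++-assoc; ++-identityʳ; ++-cancelˡ; length-++; ∷-injectiveˡ)
open import Data.List.Membership.Propositional using (_∈_)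
open import Data.List.Relation.Unary.Any using (here; there)
open import Data.List.Relation.Unary.All as All using (All; []; _∷_)
open import Data.Maybe using (just)
open import Relation.Unary using (Pred; _⊆_)
open import Relation.Binary.Definitions using (Total; DecidableEquality)
open import Relation.Binary.PropositionalEquality
  using (_≡_; _≢_; refl; sym; trans; cong; cong₂; subst; module ≡-Reasoning)
open import Relation.Nullary using (Dec; yes; no; ¬_)
open import Relation.Nullary.Decidable using (True; toWitness; fromWitness; map′; decidable-stable)

private
  variable
    a b ℓ p r : Level

bounded-attains-max : ExcludedMiddle ℓ → {T : Set ℓ} (f : T → ℕ) (N : ℕ) →
                      T → (∀ x → f x ≤ N) → Σ T λ x → ∀ y → f y ≤ f x
bounded-attains-max lem f zero x₀ bound = x₀ , λ y → ≤-trans (bound y) z≤n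
bounded-attains-max lem {T} f (Nat.suc N) x₀ bound with lem {Σ T λ x → Nat.suc N ≤ f x}
... | yes (x , N<fx) = x , λ y → ≤-trans (bound y) N<fx
... | no ∄ = bounded-attains-max lem f N x₀ λ y → ≤-pred (≰⇒> λ N<fy → ∄ (y , N<fy))

¬∀⇒∃¬ : ExcludedMiddle (a ⊔ b) → {A : Set a} {B : A → Set b} →
        (∀ x → Dec (B x)) → ¬ (∀ x → B x) → ∃ λ x → ¬ B x
¬∀⇒∃¬ lem B? ¬∀ with lem
... | yes ∃¬ = ∃¬
... | no ∄¬ = ⊥-elim (¬∀ λ x → decidable-stable (B? x) λ ¬Bx → ∄¬ (x , ¬Bx))

++-nonempty-prefixes-meet : {A : Set a} (xs ys zs ws : List A) → xs ≢ [] → zs ≢ [] →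
                            xs ++ ys ≡ zs ++ ws → ∃ λ x → x ∈ xs × x ∈ zs
++-nonempty-prefixes-meet []       _ _        _ xs≢[] _     _  = ⊥-elim (xs≢[] refl)
++-nonempty-prefixes-meet (_ ∷ _)  _ []       _ _     zs≢[] _  = ⊥-elim (zs≢[] refl)
++-nonempty-prefixes-meet (x ∷ _)  _ (_ ∷ _)  _ _     _     eq = x , here refl , here (∷-injectiveˡ eq)

length-++-≤ˡ⇒≡[] : {A : Set a} (xs : List A) {ys : List A} → length (xs ++ ys) ≤ length xs → ys ≡ []
length-++-≤ˡ⇒≡[] []       {[]}    _         = refl
length-++-≤ˡ⇒≡[] (_ ∷ xs)         (s≤s le)  = length-++-≤ˡ⇒≡[] xs le

module _ {T : Set a} {_≼_ : T → T → Set r} (total : Total _≼_)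
         {E : Set b} (Q : T → E → Set p) (mono : ∀ x y → x ≼ y → Q x ⊆ Q y) where

  common-upper-bound : T → (es : List E) → All (λ e → ∃ λ x → Q x e) es → ∃ λ x → All (Q x) es
  common-upper-bound x₀ []       []              = x₀ , []
  common-upper-bound x₀ (_ ∷ es) ((x , qx) ∷ qs) with common-upper-bound x₀ es qs
  ... | y , qys with total x y
  ...   | inj₁ x≼y = y , mono x y x≼y qx ∷ qys
  ...   | inj₂ y≼x = x , qx ∷ All.map (mono y x y≼x) qys

module Waves (D : Digraph) (Mv : (v : Digraph.V D) → FinitaryMatroid (InEdges D v))
             (s t : Digraph.V D) where

  open Digraph D
  open Setting D Mv s t
  open Wave

  endFrom∈ : ∀ v es → endFrom v es ∈ v ∷ map head es
  endFrom∈ v []       = here refl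
  endFrom∈ v (e ∷ es) = there (endFrom∈ (head e) es)

  end∈verts : ∀ q → end q ∈ verts q
  end∈verts q = endFrom∈ (Path.start q) (Path.edges q)

  last⇒endFrom≡head : ∀ v es {f} → last es ≡ just f → endFrom v es ≡ head f
  last⇒endFrom≡head v (e ∷ [])      refl = refl
  last⇒endFrom≡head v (e ∷ e′ ∷ es) eq   = last⇒endFrom≡head (head e) (e′ ∷ es) eq

  -- The second clause of w₀ ≤W w₁, for a single path q of w₁.
  Extends : Wave → P → Set
  Extends w q = Σ P λ q₀ → W w q₀ × Σ (List A) λ rest →
    Path.start q ≡ Path.start q₀ × Path.edges q ≡ Path.edges q₀ ++ rest ×
    All (λ e → X w (head e)) rest

  module _ (w : Wave) (q : P) (wq : W w q) where

    end∈X : X w (end q)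
    end∈X = proj₁ (proj₂ (proj₂ (paths w q wq)))

    X∩verts⊆end : ∀ {u} → u ∈ verts q → X w u → u ≡ end q
    X∩verts⊆end u∈q = proj₂ (proj₂ (proj₂ (paths w q wq))) _ u∈q

    edges≢[] : Path.edges q ≢ []
    edges≢[] no-edges = proj₂ (cut w) (subst (X w) end≡s end∈X)
      where
      end≡s : end q ≡ s
      end≡s = trans (cong (endFrom (Path.start q)) no-edges)
                    (proj₁ (proj₁ (proj₂ (paths w q wq))))

  extends-length-≤ : ∀ w q → ((q₀ , _) : Extends w q) → length (Path.edges q₀) ≤ length (Path.edges q)
  extends-length-≤ _ q (q₀ , _ , _ , _ , ed , _) =
    subst (length (Path.edges q₀) ≤_)
          (sym (trans (cong length ed) (length-++ (Path.edges q₀))))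
          (m≤m+n _ _)

  ≤W-retains : ∀ w₀ w₁ {q} → w₀ ≤W w₁ → W w₀ q → X w₁ (end q) → W w₁ q
  ≤W-retains _ _ {q} (_ , _ , meets) wq x = meets q wq (end q , end∈verts q , x)

  ≤W-antisym : ∀ w w′ → w ≤W w′ → w′ ≤W w → w ≈W w′
  ≤W-antisym w w′ w≤w′ w′≤w =
    (λ q → (λ wq → ≤W-retains w w′ w≤w′ wq (proj₁ w′≤w (end∈X w q wq)))
         , (λ wq → ≤W-retains w′ w w′≤w wq (proj₁ w≤w′ (end∈X w′ q wq))))
    , λ v → proj₁ w′≤w , proj₁ w≤w′

  -- Paths of a wave are nonempty and edge-disjoint, so a shared first edge identifies them.
  prefixes-in-wave-≡ : ∀ w q q′ {rest rest′} → W w q → W w q′ →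
                       Path.edges q ++ rest ≡ Path.edges q′ ++ rest′ → q ≡ q′
  prefixes-in-wave-≡ w q q′ {rest} {rest′} wq wq′ eq =
    let e , e∈q , e∈q′ = ++-nonempty-prefixes-meet (Path.edges q) rest (Path.edges q′) rest′
                           (edges≢[] w q wq) (edges≢[] w q′ wq′) eq
    in edge-disjoint w q q′ e wq wq′ e∈q e∈q′

  extends-grows : ∀ w₀ w₁ q → w₀ ≤W w₁ →
                  ((q₀ , _) : Extends w₀ q) → ((q₁ , _) : Extends w₁ q) →
                  Σ (List A) λ rest → Path.start q₁ ≡ Path.start q₀ ×
                                      Path.edges q₁ ≡ Path.edges q₀ ++ rest
  extends-grows w₀ _ q (_ , grow , _) (q₀ , wq₀ , r₀ , _ , ed₀ , _) (q₁ , wq₁ , r₁ , _ , ed₁ , _)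
    with grow q₁ wq₁
  ... | q′ , wq′ , r′ , st′ , ed′ , _ with prefixes-in-wave-≡ w₀ q′ q₀ wq′ wq₀ q′⋯≡q₀⋯
    where
    open ≡-Reasoning
    q′⋯≡q₀⋯ : Path.edges q′ ++ (r′ ++ r₁) ≡ Path.edges q₀ ++ r₀
    q′⋯≡q₀⋯ = begin
      Path.edges q′ ++ (r′ ++ r₁)   ≡⟨ ++-assoc (Path.edges q′) r′ r₁ ⟨
      (Path.edges q′ ++ r′) ++ r₁   ≡⟨ cong (_++ r₁) ed′ ⟨
      Path.edges q₁ ++ r₁           ≡⟨ ed₁ ⟨
      Path.edges q                  ≡⟨ ed₀ ⟩
      Path.edges q₀ ++ r₀           ∎
  ... | refl = r′ , st′ , ed′

  -- The length bound and extends-grows force the two predecessors of q to coincide.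
  longest-extension-stable :
    ∀ w₀ w₁ q → w₀ ≤W w₁ → (e₀ : Extends w₀ q) → (e₁ : Extends w₁ q) →
    length (Path.edges (proj₁ e₁)) ≤ length (Path.edges (proj₁ e₀)) →
    X w₁ (end (proj₁ e₀)) × All (λ e → X w₁ (head e)) (proj₁ (proj₂ (proj₂ e₀)))
  longest-extension-stable w₀ w₁ q w₀≤w₁
    e₀@(q₀ , _ , r₀ , _ , ed₀ , _) e₁@(q₁ , wq₁ , r₁ , _ , ed₁ , all₁) shorter
    with extends-grows w₀ w₁ q w₀≤w₁ e₀ e₁
  ... | rest , st , ed
    with length-++-≤ˡ⇒≡[] (Path.edges q₀) (subst (λ es → length es ≤ length (Path.edges q₀)) ed shorter)
  ... | refl = subst (λ q′ → X w₁ (end q′)) q₁≡q₀ (end∈X w₁ q₁ wq₁)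
             , subst (All (λ e → X w₁ (head e))) r₁≡r₀ all₁
    where
    edges₁≡edges₀ : Path.edges q₁ ≡ Path.edges q₀
    edges₁≡edges₀ = trans ed (++-identityʳ (Path.edges q₀))
    q₁≡q₀ : q₁ ≡ q₀
    q₁≡q₀ = cong₂ path st edges₁≡edges₀
    r₁≡r₀ : r₁ ≡ r₀
    r₁≡r₀ = ++-cancelˡ (Path.edges q₀) r₁ r₀
              (trans (cong (_++ r₁) (sym edges₁≡edges₀)) (trans (sym ed₁) ed₀))

  dependence-local : DecidableEquality V → ∀ {I e} → indepM I →
                     ¬ indepM (λ f → f ≡ e ⊎ I f) →
                     ¬ indepM (λ f → f ≡ e ⊎ (I f × head f ≡ head e))
  dependence-local _≟_ {I} {e} indep-I dependent indep-local =
    dependent λ v → indep-at v (v ≟ head e)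
    where
    indep-at : ∀ v → Dec (v ≡ head e) → FinitaryMatroid.indep (Mv v) (λ x → proj₁ x ≡ e ⊎ I (proj₁ x))
    indep-at v (yes refl) = FinitaryMatroid.indep-down (Mv v)
      (λ { (inj₁ f≡e) → inj₁ f≡e ; {_ , head≡} (inj₂ If) → inj₂ (If , head≡) })
      (indep-local v)
    indep-at v (no v≢head-e) = FinitaryMatroid.indep-down (Mv v)
      (λ { {_ , head≡} (inj₁ refl) → ⊥-elim (v≢head-e (sym head≡)) ; (inj₂ If) → If })
      (indep-I v)

module Supremum (lem : ExcludedMiddle (suc 0ℓ))
                (D : Digraph) (Mv : (v : Digraph.V D) → FinitaryMatroid (InEdges D v))
                (s t : Digraph.V D)
                (𝒳 : Pred (Setting.Wave D Mv s t) 0ℓ)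
                (nonempty : Σ (Setting.Wave D Mv s t) 𝒳)
                (chain : ∀ w w′ → 𝒳 w → 𝒳 w′ →
                   Setting._≤W_ D Mv s t w w′ ⊎ Setting._≤W_ D Mv s t w′ w) where

  open Digraph D
  open Setting D Mv s t
  open Wave
  open Waves D Mv s t

  dec : (Q : Set) → Dec Q
  dec Q = map′ lower lift (lem {Lift _ Q})

  Member : Set₁
  Member = Σ Wave 𝒳

  _≼_ : Member → Member → Set
  (w , _) ≼ (w′ , _) = w ≤W w′

  ≼-total : Total _≼_
  ≼-total (w , w∈) (w′ , w′∈) = chain w w′ w∈ w′∈

  -- Excluded middle turns the Set₁-propositions below into Sets via True.
  XS : Pred V 0ℓ
  XS v = True (lem {∀ ((w , _) : Member) → X w v})

  XS⊆X : ∀ ((w , _) : Member) {v} → XS v → X w v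
  XS⊆X x v∈XS = toWitness v∈XS x

  Carries : Member → P → Set
  Carries (w , _) q = W w q × XS (end q)

  carries-mono : ∀ x y → x ≼ y → Carries x ⊆ Carries y
  carries-mono (w , _) y@(w′ , _) x≼y (wq , q∈XS) = ≤W-retains w w′ x≼y wq (XS⊆X y q∈XS) , q∈XS

  WS : PathSystem
  WS q = True (lem {∃ λ x → Carries x q})

  carried-by-WS : ∀ x {q} → W (proj₁ x) q → XS (end q) → WS q
  carried-by-WS x wq q∈XS = fromWitness (x , wq , q∈XS)

  cutS : IsCut XS
  cutS = fromWitness (λ (w , _) → proj₁ (cut w))
       , λ s∈XS → proj₂ (cut (proj₁ nonempty)) (XS⊆X nonempty s∈XS)

  pathsS : ∀ q → WS q → IsPathFromTo (λ v → v ≡ s) XS q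
  pathsS q q∈WS with toWitness q∈WS
  ... | x@(w , _) , wq , q∈XS with paths w q wq
  ...   | is-path , from-s , _ , end-unique =
          is-path , from-s , q∈XS , λ u u∈q u∈XS → end-unique u u∈q (XS⊆X x u∈XS)

  edge-disjointS : ∀ q q′ e → WS q → WS q′ → e ∈ Path.edges q → e ∈ Path.edges q′ → q ≡ q′
  edge-disjointS q q′ e q∈WS q′∈WS e∈q e∈q′
    with common-upper-bound ≼-total Carries carries-mono nonempty (q ∷ q′ ∷ [])
           (toWitness q∈WS ∷ toWitness q′∈WS ∷ [])
  ... | (w , _) , (wq , _) ∷ (wq′ , _) ∷ [] = edge-disjoint w q q′ e wq wq′ e∈q e∈q′

  CarriesEdge : Member → A → Set
  CarriesEdge x e = Σ P λ q → Carries x q × e ∈ Path.edges q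

  carries-edge-mono : ∀ x y → x ≼ y → CarriesEdge x ⊆ CarriesEdge y
  carries-edge-mono x y x≼y (q , cq , e∈q) = q , carries-mono x y x≼y cq , e∈q

  independentS : indepM (Edges WS)
  independentS v = FinitaryMatroid.indep-finitary (Mv v) _ λ es es⊆ →
    let x , carried = common-upper-bound ≼-total (λ x (e : InEdges D v) → CarriesEdge x (proj₁ e))
                        (λ x y x≼y → carries-edge-mono x y x≼y) nonempty es (All.tabulate (witness es⊆))
    in FinitaryMatroid.indep-down (Mv v) (λ e∈es → edge-of-W x (All.lookup carried e∈es))
                                  (independent (proj₁ x) v)
    where
    witness : ∀ {es} → (∀ e → e ∈ es → Edges WS (proj₁ e)) →
              ∀ {e} → e ∈ es → ∃ λ x → CarriesEdge x (proj₁ e)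
    witness es⊆ {e} e∈es = let q , q∈WS , e∈q = es⊆ e e∈es
                               x , cq = toWitness q∈WS
                           in x , q , cq , e∈q
    edge-of-W : ∀ x {e} → CarriesEdge x e → Edges (W (proj₁ x)) e
    edge-of-W _ (q , (wq , _) , e∈q) = q , wq , e∈q

  last-in-XS⇒WS : ∀ x {q f} → W (proj₁ x) q → last (Path.edges q) ≡ just f → XS (head f) → WS q
  last-in-XS⇒WS x {q} wq last≡f f∈XS =
    carried-by-WS x wq (subst XS (sym (last⇒endFrom≡head (Path.start q) (Path.edges q) last≡f)) f∈XS)

  spanningS : Spans (LastEdges WS) (InD XS)
  spanningS e (head∈XS , tail∉XS)
    with ¬∀⇒∃¬ lem (λ ((w , _) : Member) → dec (X w (tail e))) (λ ∀X → tail∉XS (fromWitness ∀X))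
  ... | x@(w , _) , tail∉X with spanning w e (XS⊆X x head∈XS , tail∉X)
  ...   | inj₁ (q , wq , last≡e) = inj₁ (q , last-in-XS⇒WS x wq last≡e head∈XS , last≡e)
  ...   | inj₂ (I , I⊆last , indep-I , dependent) =
          inj₂ ( (λ f → I f × head f ≡ head e)
               , (λ { (If , head≡) → let q , wq , last≡f = I⊆last If in
                       q , last-in-XS⇒WS x wq last≡f (subst XS (sym head≡) head∈XS) , last≡f })
               , (λ v → FinitaryMatroid.indep-down (Mv v) proj₁ (indep-I v))
               , dependence-local (λ u v → dec (u ≡ v)) indep-I dependent )

  S : Wave
  S = record { W = WS ; X = XS ; cut = cutS ; paths = pathsS ; edge-disjoint = edge-disjointS
             ; independent = independentS ; spanning = spanningS }

  S-upper : IsUpperBound 𝒳 S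
  S-upper w w∈ = (λ v∈XS → XS⊆X (w , w∈) v∈XS) , extends , meets
    where
    extends : ∀ q → WS q → Extends w q
    extends q q∈WS with toWitness q∈WS
    ... | y , cq with ≼-total y (w , w∈)
    ...   | inj₁ y≼w = q , proj₁ (carries-mono y (w , w∈) y≼w cq) , [] , refl , sym (++-identityʳ _) , []
    ...   | inj₂ w≼y = proj₁ (proj₂ w≼y) q (proj₁ cq)
    meets : ∀ q → W w q → Σ V (λ u → u ∈ verts q × XS u) → WS q
    meets q wq (u , u∈q , u∈XS) =
      carried-by-WS (w , w∈) wq (subst XS (X∩verts⊆end w q wq u∈q (XS⊆X (w , w∈) u∈XS)) u∈XS)

  module LongestPredecessor (u : Wave) (upper : IsUpperBound 𝒳 u) (q : P) (wq : W u q) where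

    predecessor : ((w , _) : Member) → Extends w q
    predecessor (w , w∈) = proj₁ (proj₂ (upper w w∈)) q wq

    predecessor-length : Member → ℕ
    predecessor-length x = length (Path.edges (proj₁ (predecessor x)))

    longest : Σ Member λ x → ∀ y → predecessor-length y ≤ predecessor-length x
    longest = bounded-attains-max lem predecessor-length (length (Path.edges q)) nonempty
                                  (λ x → extends-length-≤ (proj₁ x) q (predecessor x))

    x* : Member
    x* = proj₁ longest

    q* : P
    q* = proj₁ (predecessor x*)

    rest* : List A
    rest* = proj₁ (proj₂ (proj₂ (predecessor x*)))

    in-every-cut : ∀ y → X (proj₁ y) (end q*) × All (λ e → X (proj₁ y) (head e)) rest*
    in-every-cut y with ≼-total x* y
    ... | inj₁ x*≼y = longest-extension-stable (proj₁ x*) (proj₁ y) q x*≼y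
                        (predecessor x*) (predecessor y) (proj₂ longest y)
    ... | inj₂ y≼x* = let _ , wq* , _ , _ , _ , all* = predecessor x* in
                      proj₁ y≼x* (end∈X (proj₁ x*) q* wq*) , All.map (proj₁ y≼x*) all*

    extendsS : Extends S q
    extendsS =
      let _ , wq* , _ , st* , ed* , _ = predecessor x* in
      q* , carried-by-WS x* wq* (fromWitness λ y → proj₁ (in-every-cut y)) , rest* , st* , ed*
      , All.tabulate λ e∈ → fromWitness λ y → All.lookup (proj₂ (in-every-cut y)) e∈

  S-least : ∀ u → IsUpperBound 𝒳 u → S ≤W u
  S-least u upper =
      (λ v∈X → fromWitness λ (w , w∈) → proj₁ (upper w w∈) v∈X)
    , (λ q wq → LongestPredecessor.extendsS u upper q wq)
    , λ q q∈WS meets → let (w , w∈) , wq , _ = toWitness q∈WS in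
                       proj₂ (proj₂ (upper w w∈)) q wq meets

lemma8 : ExcludedMiddle (suc 0ℓ) →
    (D : Digraph) →
    (Mv : (v : Digraph.V D) → FinitaryMatroid (InEdges D v)) →
    (s t : Digraph.V D) → s ≢ t →
    Setting.NoLoops D Mv s t →
    (𝒳 : Pred (Setting.Wave D Mv s t) 0ℓ) →
    Σ (Setting.Wave D Mv s t) 𝒳 →
    (∀ w w' → 𝒳 w → 𝒳 w' →
      Setting._≤W_ D Mv s t w w' ⊎ Setting._≤W_ D Mv s t w' w) →
    Σ (Setting.Wave D Mv s t) (λ S →
      Setting.IsSup D Mv s t 𝒳 S ×
      (∀ S' → Setting.IsSup D Mv s t 𝒳 S' → Setting._≈W_ D Mv s t S S'))
lemma8 lem D Mv s t _ _ 𝒳 nonempty chain =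
  S , (S-upper , S-least) ,
  λ S′ (S′-upper , S′-least) → ≤W-antisym S S′ (S-least S′ S′-upper) (S′-least S S-upper)
  where
  open Supremum lem D Mv s t 𝒳 nonempty chain
  open Waves D Mv s t
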